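{- In $\mathbb{Z}_2^n$, the maximum size of a cap contained in a $6$-flat is $M(6)=9$, and the smallest dimension of a $10$-cap is $r_{10}=7$.
   Context: $\mathbb{Z}_2^n$ is the $n$-dimensional vector space over $\mathbb{Z}_2$ (with $n$ large enough for the relevant flats and caps to exist). A quad is a set of four distinct elements $a,b,c,d$ with $a+b+c+d=\vec 0$; a cap is a subset containing no quad; a $k$-cap is a cap with $k$ elements. Over $\mathbb{Z}_2$, affine combinations are sums of an odd number of elements and $\mathrm{aff}(S)$ is the set of affine combinations of elements of $S$; an $r$-flat is the affine span of $r+1$ affinely independent points. The dimension of a cap $C$ is the dimension of $\mathrm{aff}(C)$. $M(r)$ denotes the maximal size of a cap contained in an $r$-flat, and $r_k$ denotes the smallest possible dimension of a $k$-cap. -}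

module Defs where

open import Data.Nat using (ℕ; zero; suc; _≤_)
open import Data.Bool using (Bool; true; false; _xor_)
open import Data.Fin using (Fin)
import Data.Fin as F
open import Data.Vec using (Vec; replicate; zipWith)
open import Data.Product using (Σ; ∃; _×_; _,_)
open import Relation.Binary.PropositionalEquality using (_≡_; _≢_)
open import Relation.Nullary using (¬_)
open import Function.Bundles using (_⇔_)
open import Function.Definitions using (Injective)

V : ℕ → Set
V n = Vec Bool n

𝟎 : ∀ {n} → V n
𝟎 = replicate _ false

infixl 6 _⊕_
_⊕_ : ∀ {n} → V n → V n → V n
_⊕_ = zipWith _xor_

sumSel : ∀ {k n} → (Fin k → V n) → (Fin k → Bool) → V n
sumSel {zero}  p s = 𝟎
sumSel {suc k} p s with s F.zero
... | true  = p F.zero ⊕ sumSel (λ i → p (F.suc i)) (λ i → s (F.suc i))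
... | false = sumSel (λ i → p (F.suc i)) (λ i → s (F.suc i))

parity : ∀ {k} → (Fin k → Bool) → Bool
parity {zero}  s = false
parity {suc k} s = s F.zero xor parity (λ i → s (F.suc i))

-- x ∈ aff(p): x is a sum of an odd number of the points p i.
-- (Over Z_2, sums of an odd number of elements with repetition reduce to
-- sums over odd-size subsets.)
InAff : ∀ {k n} → (Fin k → V n) → V n → Set
InAff p x = Σ (_ → Bool) λ s → parity s ≡ true × sumSel p s ≡ x

-- Affine independence: no nontrivial affine dependence, i.e. no nonempty
-- even-size subset summing to zero.
AffIndep : ∀ {k n} → (Fin k → V n) → Set
AffIndep p = ∀ s → parity s ≡ false → sumSel p s ≡ 𝟎 → ∀ i → s i ≡ false

IsCap : ∀ {k n} → (Fin k → V n) → Set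
IsCap c = Injective _≡_ _≡_ c ×
  (∀ i j k l → i ≢ j → i ≢ k → i ≢ l → j ≢ k → j ≢ l → k ≢ l →
     c i ⊕ c j ⊕ c k ⊕ c l ≢ 𝟎)

CapInFlat : ∀ {r k n} → (Fin (suc r) → V n) → (Fin k → V n) → Set
CapInFlat p c = AffIndep p × (∀ i → InAff p (c i))

HasDim : ∀ {k n} → (Fin k → V n) → ℕ → Set
HasDim {n = n} c d = Σ (Fin (suc d) → V n) λ q →
  AffIndep q × (∀ x → InAff c x ⇔ InAff q x)

IsM : ℕ → ℕ → Set
IsM r m =
  (∃ λ n → Σ (Fin (suc r) → V n) λ p → Σ (Fin m → V n) λ c →
     IsCap c × CapInFlat p c)
  × (∀ n (p : Fin (suc r) → V n) k (c : Fin k → V n) →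
       IsCap c → CapInFlat p c → k ≤ m)

IsR : ℕ → ℕ → Set
IsR k d =
  (∃ λ n → Σ (Fin k → V n) λ c → IsCap c × HasDim c d)
  × (∀ n (c : Fin k → V n) e → IsCap c → HasDim c e → d ≤ e)

-- Suppose a 10-cap c lies in the affine span of at most 7 points p. Writing each c i as a sum
-- of an odd number of the p j gives 10 coefficient vectors in Z₂^7, so by Gaussian elimination
-- they have three independent linear dependencies. A nonzero dependency T has even size (the
-- coefficient vectors have odd weight) and Σ_{i ∈ T} c i = 0; as a cap has no two equal points
-- and no quad, |T| ≥ 6. The 7 nonzero combinations of three independent dependencies thus have
-- total size at least 42, but every index lies in at most 4 of them, so the total is at most 40.
-- Hence M(6) ≤ 9 and r₁₀ ≥ 7, and both bounds are attained by explicit caps built on the affine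
-- basis 0, e₁, …, eₘ.
module Submission where

open import Defs

open import Algebra.Bundles using (CommutativeRing; CommutativeMonoid)
open import Algebra.Definitions using (Associative; Commutative; LeftIdentity; RightIdentity)
open import Data.Bool using (Bool; true; false; _xor_; _∧_; not; if_then_else_)
open import Data.Bool.Properties
  using ( ¬-not; xor-assoc; xor-comm; xor-identityˡ; xor-identityʳ; xor-same; xor-inverseˡ
        ; xor-∧-commutativeRing; ∧-identityʳ; ∧-zeroʳ; ∧-comm; ∧-assoc; ∧-distribʳ-xor; ∧-distribˡ-xor )
  renaming (_≟_ to _≟ᵇ_)
open import Data.Fin using (Fin; zero; suc; _≟_; #_; _↑ˡ_; inject≤)
open import Data.Fin.Properties using (any?; all?; inject≤-injective)
import Data.Fin.Properties as Fin
open import Data.Nat using (ℕ; zero; suc; _+_; _*_; _<_; _≤_; _≤?_; z≤n; s≤s; s≤s⁻¹)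
open import Data.Nat.Properties using (≤-refl; ≤-trans; <⇒≤; ≰⇒>; m≤n⇒m≤1+n; suc-injective; +-mono-≤; *-suc)
open import Data.Nat.Tactic.RingSolver using (solve-∀)
open import Data.Product using (∃; _×_; _,_; proj₁; proj₂)
import Data.Vec as Vec
open import Data.Vec using (lookup; tabulate)
open import Data.Vec.Properties
  using ( ≡-dec; lookup-zipWith; lookup-replicate; lookup∘tabulate; tabulate∘lookup; tabulate-cong
        ; zipWith-assoc; zipWith-comm; zipWith-identityˡ; zipWith-identityʳ )
open import Data.Vec.Functional using (Vector; head; tail; updateAt; _∷_; []; _++_)
open import Data.Vec.Functional.Properties using (updateAt-updates; updateAt-minimal; lookup-++ˡ)
open import Function using (_∘_; const; id)
open import Function.Bundles using (mk⇔; Equivalence)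
open import Function.Definitions using (Injective)
open import Relation.Binary.PropositionalEquality
open import Relation.Nullary using (¬_; Dec; yes; no; contradiction; ¬?; _×-dec_; _→-dec_)
open import Relation.Nullary.Decidable using (from-yes; from-no; map′)
open import Algebra.Properties.CommutativeSemigroup
  (CommutativeMonoid.commutativeSemigroup (CommutativeRing.+-commutativeMonoid xor-∧-commutativeRing))
  using () renaming (interchange to xor-interchange)
open ≡-Reasoning

private variable d k m n : ℕ

⊕-assoc : Associative _≡_ (_⊕_ {n})
⊕-assoc = zipWith-assoc xor-assoc

⊕-comm : Commutative _≡_ (_⊕_ {n})
⊕-comm = zipWith-comm xor-comm

⊕-identityˡ : LeftIdentity _≡_ 𝟎 (_⊕_ {n})
⊕-identityˡ = zipWith-identityˡ xor-identityˡ

⊕-identityʳ : RightIdentity _≡_ 𝟎 (_⊕_ {n})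
⊕-identityʳ = zipWith-identityʳ xor-identityʳ

⊕-self : (x : V n) → x ⊕ x ≡ 𝟎
⊕-self Vec.[]      = refl
⊕-self (b Vec.∷ x) = cong₂ Vec._∷_ (xor-same b) (⊕-self x)

⊕-interchange : (w x y z : V n) → (w ⊕ x) ⊕ (y ⊕ z) ≡ (w ⊕ y) ⊕ (x ⊕ z)
⊕-interchange w x y z = begin
  (w ⊕ x) ⊕ (y ⊕ z)  ≡⟨ ⊕-assoc w x (y ⊕ z) ⟩
  w ⊕ (x ⊕ (y ⊕ z))  ≡⟨ cong (w ⊕_) (sym (⊕-assoc x y z)) ⟩
  w ⊕ ((x ⊕ y) ⊕ z)  ≡⟨ cong (λ u → w ⊕ (u ⊕ z)) (⊕-comm x y) ⟩
  w ⊕ ((y ⊕ x) ⊕ z)  ≡⟨ cong (w ⊕_) (⊕-assoc y x z) ⟩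
  w ⊕ (y ⊕ (x ⊕ z))  ≡⟨ sym (⊕-assoc w y (x ⊕ z)) ⟩
  (w ⊕ y) ⊕ (x ⊕ z)  ∎

⊕-cancel : (x y : V n) → x ⊕ y ≡ 𝟎 → x ≡ y
⊕-cancel x y x⊕y≡𝟎 = begin
  x            ≡⟨ sym (⊕-identityʳ x) ⟩
  x ⊕ 𝟎        ≡⟨ cong (x ⊕_) (sym (⊕-self y)) ⟩
  x ⊕ (y ⊕ y)  ≡⟨ sym (⊕-assoc x y y) ⟩
  (x ⊕ y) ⊕ y  ≡⟨ cong (_⊕ y) x⊕y≡𝟎 ⟩
  𝟎 ⊕ y        ≡⟨ ⊕-identityˡ y ⟩
  y            ∎

infixr 7 _·_
_·_ : Bool → V n → V n
b · x = if b then x else 𝟎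

·-distrib-xor : ∀ a b (x : V n) → (a xor b) · x ≡ a · x ⊕ b · x
·-distrib-xor true  true  x = sym (⊕-self x)
·-distrib-xor true  false x = sym (⊕-identityʳ x)
·-distrib-xor false true  x = sym (⊕-identityˡ x)
·-distrib-xor false false x = sym (⊕-identityˡ 𝟎)

lookup-· : ∀ b (x : V n) (j : Fin n) → lookup (b · x) j ≡ b ∧ lookup x j
lookup-· true  x j = refl
lookup-· false x j = lookup-replicate j false

Sel : ℕ → Set
Sel = Vector Bool

infixl 6 _⊕ˢ_
_⊕ˢ_ : Sel k → Sel k → Sel k
(S ⊕ˢ T) i = S i xor T i

∅ : Sel k
∅ = const false

⁅_⁆ : Fin k → Sel k
⁅ i ⁆ = updateAt ∅ i (const true)

sumSel-suc : (p : Fin (suc k) → V n) (S : Sel (suc k)) →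
  sumSel p S ≡ head S · head p ⊕ sumSel (tail p) (tail S)
sumSel-suc p S with S zero
... | true  = refl
... | false = sym (⊕-identityˡ _)

sumSel-cong : {p q : Fin k → V n} {S T : Sel k} → p ≗ q → S ≗ T → sumSel p S ≡ sumSel q T
sumSel-cong {zero}  p≗q S≗T = refl
sumSel-cong {suc k} {p = p} {q} {S} {T} p≗q S≗T = begin
  sumSel p S                                  ≡⟨ sumSel-suc p S ⟩
  head S · head p ⊕ sumSel (tail p) (tail S)  ≡⟨ cong₂ _⊕_ (cong₂ _·_ (S≗T zero) (p≗q zero))
                                                            (sumSel-cong (p≗q ∘ suc) (S≗T ∘ suc)) ⟩
  head T · head q ⊕ sumSel (tail q) (tail T)  ≡⟨ sym (sumSel-suc q T) ⟩
  sumSel q T                                  ∎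

sumSel-∅ : (p : Fin k → V n) → sumSel p ∅ ≡ 𝟎
sumSel-∅ {zero}  p = refl
sumSel-∅ {suc k} p = sumSel-∅ (tail p)

sumSel-⊕ : (p : Fin k → V n) (S T : Sel k) → sumSel p (S ⊕ˢ T) ≡ sumSel p S ⊕ sumSel p T
sumSel-⊕ {zero}  p S T = sym (⊕-identityˡ 𝟎)
sumSel-⊕ {suc k} p S T = begin
  sumSel p (S ⊕ˢ T)
    ≡⟨ sumSel-suc p (S ⊕ˢ T) ⟩
  (head S xor head T) · head p ⊕ sumSel (tail p) (tail S ⊕ˢ tail T)
    ≡⟨ cong₂ _⊕_ (·-distrib-xor (head S) (head T) (head p)) (sumSel-⊕ (tail p) (tail S) (tail T)) ⟩
  (head S · head p ⊕ head T · head p) ⊕ (sumSel (tail p) (tail S) ⊕ sumSel (tail p) (tail T))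
    ≡⟨ ⊕-interchange _ _ _ _ ⟩
  (head S · head p ⊕ sumSel (tail p) (tail S)) ⊕ (head T · head p ⊕ sumSel (tail p) (tail T))
    ≡⟨ sym (cong₂ _⊕_ (sumSel-suc p S) (sumSel-suc p T)) ⟩
  sumSel p S ⊕ sumSel p T
    ∎

sumSel-∧ : (p : Fin k → V n) (b : Bool) (S : Sel k) → sumSel p (λ i → b ∧ S i) ≡ b · sumSel p S
sumSel-∧ p true  S = refl
sumSel-∧ p false S = sumSel-∅ p

sumSel-⁅⁆ : (p : Fin k → V n) (i : Fin k) → sumSel p ⁅ i ⁆ ≡ p i
sumSel-⁅⁆ p zero    = trans (cong (p zero ⊕_) (sumSel-∅ (tail p))) (⊕-identityʳ (p zero))
sumSel-⁅⁆ p (suc i) = sumSel-⁅⁆ (tail p) i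

parity-cong : {S T : Sel k} → S ≗ T → parity S ≡ parity T
parity-cong {zero}  S≗T = refl
parity-cong {suc k} S≗T = cong₂ _xor_ (S≗T zero) (parity-cong (S≗T ∘ suc))

parity-∅ : parity {k} ∅ ≡ false
parity-∅ {zero}  = refl
parity-∅ {suc k} = parity-∅ {k}

parity-⊕ : (S T : Sel k) → parity (S ⊕ˢ T) ≡ parity S xor parity T
parity-⊕ {zero}  S T = refl
parity-⊕ {suc k} S T = begin
  (head S xor head T) xor parity (tail S ⊕ˢ tail T)
    ≡⟨ cong ((head S xor head T) xor_) (parity-⊕ (tail S) (tail T)) ⟩
  (head S xor head T) xor (parity (tail S) xor parity (tail T))
    ≡⟨ xor-interchange (head S) (head T) (parity (tail S)) (parity (tail T)) ⟩
  (head S xor parity (tail S)) xor (head T xor parity (tail T))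
    ∎

parity-∧ : ∀ b (S : Sel k) → parity (λ i → b ∧ S i) ≡ b ∧ parity S
parity-∧     true  S = refl
parity-∧ {k} false S = parity-∅ {k}

parity-∧ʳ : (S : Sel k) (b : Bool) → parity (λ i → S i ∧ b) ≡ parity S ∧ b
parity-∧ʳ S b = begin
  parity (λ i → S i ∧ b)  ≡⟨ parity-cong (λ i → ∧-comm (S i) b) ⟩
  parity (λ i → b ∧ S i)  ≡⟨ parity-∧ b S ⟩
  b ∧ parity S            ≡⟨ ∧-comm b (parity S) ⟩
  parity S ∧ b            ∎

parity-⁅⁆ : (i : Fin k) → parity ⁅ i ⁆ ≡ true
parity-⁅⁆ {suc k} zero    = cong (true xor_) (parity-∅ {k})
parity-⁅⁆ {suc k} (suc i) = parity-⁅⁆ i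

parity-⁅⁆∧ : (i : Fin k) (S : Sel k) → parity (λ j → ⁅ i ⁆ j ∧ S j) ≡ S i
parity-⁅⁆∧ {suc k} zero    S = trans (cong (S zero xor_) (parity-∅ {k})) (xor-identityʳ (S zero))
parity-⁅⁆∧ {suc k} (suc i) S = parity-⁅⁆∧ i (tail S)

lookup-sumSel : (p : Fin k → V n) (S : Sel k) (j : Fin n) →
  lookup (sumSel p S) j ≡ parity (λ i → S i ∧ lookup (p i) j)
lookup-sumSel {zero}  p S j = lookup-replicate j false
lookup-sumSel {suc k} p S j = begin
  lookup (sumSel p S) j
    ≡⟨ cong (λ x → lookup x j) (sumSel-suc p S) ⟩
  lookup (head S · head p ⊕ sumSel (tail p) (tail S)) j
    ≡⟨ lookup-zipWith _xor_ j (head S · head p) _ ⟩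
  lookup (head S · head p) j xor lookup (sumSel (tail p) (tail S)) j
    ≡⟨ cong₂ _xor_ (lookup-· (head S) (head p) j) (lookup-sumSel (tail p) (tail S) j) ⟩
  parity (λ i → S i ∧ lookup (p i) j)
    ∎

-- combine T w is the row vector T times the matrix with rows w i, i.e. the coefficients of Σ_{i ∈ T} w i.
combine : Sel k → (Fin k → Sel m) → Sel m
combine T w j = parity (λ i → T i ∧ w i j)

combine-⊕ : (S T : Sel k) (w : Fin k → Sel m) (j : Fin m) →
  combine (S ⊕ˢ T) w j ≡ combine S w j xor combine T w j
combine-⊕ S T w j = trans (parity-cong (λ i → ∧-distribʳ-xor (w i j) (S i) (T i)))
                          (parity-⊕ (λ i → S i ∧ w i j) (λ i → T i ∧ w i j))

combine-add-row : (T : Sel k) (β : Bool) (r : Fin k) (w : Fin k → Sel m) (j : Fin m) →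
  combine (T ⊕ˢ (λ i → β ∧ ⁅ r ⁆ i)) w j ≡ combine T w j xor (β ∧ w r j)
combine-add-row T β r w j = begin
  combine (T ⊕ˢ (λ i → β ∧ ⁅ r ⁆ i)) w j
    ≡⟨ combine-⊕ T (λ i → β ∧ ⁅ r ⁆ i) w j ⟩
  combine T w j xor parity (λ i → (β ∧ ⁅ r ⁆ i) ∧ w i j)
    ≡⟨ cong (combine T w j xor_) (parity-cong (λ i → ∧-assoc β (⁅ r ⁆ i) (w i j))) ⟩
  combine T w j xor parity (λ i → β ∧ (⁅ r ⁆ i ∧ w i j))
    ≡⟨ cong (combine T w j xor_) (parity-∧ β (λ i → ⁅ r ⁆ i ∧ w i j)) ⟩
  combine T w j xor (β ∧ parity (λ i → ⁅ r ⁆ i ∧ w i j))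
    ≡⟨ cong (λ b → combine T w j xor (β ∧ b)) (parity-⁅⁆∧ r (λ i → w i j)) ⟩
  combine T w j xor (β ∧ w r j)
    ∎

sumSel-combine : (p : Fin m → V n) (T : Sel k) (w : Fin k → Sel m) →
  sumSel p (combine T w) ≡ sumSel (λ i → sumSel p (w i)) T
sumSel-combine {k = zero}  p T w = sumSel-∅ p
sumSel-combine {k = suc k} p T w = begin
  sumSel p ((λ j → head T ∧ head w j) ⊕ˢ combine (tail T) (tail w))
    ≡⟨ sumSel-⊕ p _ _ ⟩
  sumSel p (λ j → head T ∧ head w j) ⊕ sumSel p (combine (tail T) (tail w))
    ≡⟨ cong₂ _⊕_ (sumSel-∧ p (head T) (head w)) (sumSel-combine p (tail T) (tail w)) ⟩
  head T · sumSel p (head w) ⊕ sumSel (λ i → sumSel p (tail w i)) (tail T)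
    ≡⟨ sym (sumSel-suc (λ i → sumSel p (w i)) T) ⟩
  sumSel (λ i → sumSel p (w i)) T
    ∎

parity-combine : (T : Sel k) (w : Fin k → Sel m) →
  parity (combine T w) ≡ parity (λ i → T i ∧ parity (w i))
parity-combine {zero}  {m} T w = parity-∅ {m}
parity-combine {suc k} T w = begin
  parity ((λ j → head T ∧ head w j) ⊕ˢ combine (tail T) (tail w))
    ≡⟨ parity-⊕ (λ j → head T ∧ head w j) (combine (tail T) (tail w)) ⟩
  parity (λ j → head T ∧ head w j) xor parity (combine (tail T) (tail w))
    ≡⟨ cong₂ _xor_ (parity-∧ (head T) (head w)) (parity-combine (tail T) (tail w)) ⟩
  (head T ∧ parity (head w)) xor parity (λ i → tail T i ∧ parity (tail w i))
    ∎

parity-combine-odd : (T : Sel k) (w : Fin k → Sel m) → (∀ i → parity (w i) ≡ true) →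
  parity (combine T w) ≡ parity T
parity-combine-odd T w w-odd = begin
  parity (combine T w)               ≡⟨ parity-combine T w ⟩
  parity (λ i → T i ∧ parity (w i))  ≡⟨ parity-cong (λ i → trans (cong (T i ∧_) (w-odd i)) (∧-identityʳ (T i))) ⟩
  parity T                           ∎

InAff-point : (p : Fin k → V n) (i : Fin k) → InAff p (p i)
InAff-point p i = ⁅ i ⁆ , parity-⁅⁆ i , sumSel-⁅⁆ p i

InAff-trans : {a : Fin k → V n} {b : Fin m → V n} → (∀ i → InAff b (a i)) → ∀ {x} → InAff a x → InAff b x
InAff-trans {a = a} {b} a∈aff-b {x} (S , S-odd , S-sum) =
  combine S w , trans (parity-combine-odd S w (proj₁ ∘ proj₂ ∘ a∈aff-b)) S-odd , (begin
    sumSel b (combine S w)           ≡⟨ sumSel-combine b S w ⟩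
    sumSel (λ i → sumSel b (w i)) S  ≡⟨ sumSel-cong (proj₂ ∘ proj₂ ∘ a∈aff-b) (λ _ → refl) ⟩
    sumSel a S                       ≡⟨ S-sum ⟩
    x                                ∎)
  where
  w = proj₁ ∘ a∈aff-b

bit : Bool → ℕ
bit b = if b then 1 else 0

size : Sel k → ℕ
size {zero}  S = 0
size {suc k} S = bit (head S) + size (tail S)

Nonempty : Sel k → Set
Nonempty S = ∃ λ i → S i ≡ true

infix 4 _⊆_
_⊆_ : Sel k → Sel k → Set
S ⊆ T = ∀ {i} → S i ≡ true → T i ≡ true

_∖_ : Sel k → Fin k → Sel k
Y ∖ i = updateAt Y i (const false)

size>0⇒nonempty : (S : Sel k) → 0 < size S → Nonempty S
size>0⇒nonempty {suc k} S 0<size with S zero in S₀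
... | true  = zero , S₀
... | false = let i , Si = size>0⇒nonempty (tail S) 0<size in suc i , Si

nonempty⇒size>0 : (S : Sel k) → Nonempty S → 0 < size S
nonempty⇒size>0 S (zero , S₀) rewrite S₀ = s≤s z≤n
nonempty⇒size>0 S (suc i , Si) with S zero
... | true  = s≤s z≤n
... | false = nonempty⇒size>0 (tail S) (i , Si)

size-∖ : (Y : Sel k) {i : Fin k} → Y i ≡ true → size Y ≡ suc (size (Y ∖ i))
size-∖ Y {zero}  Y₀ rewrite Y₀ = refl
size-∖ Y {suc i} Yi with Y zero
... | true  = cong suc (size-∖ (tail Y) Yi)
... | false = size-∖ (tail Y) Yi

∖-⊆ : (Y : Sel k) (i : Fin k) → Y ∖ i ⊆ Y
∖-⊆ Y i {j} Y∖i-j with j ≟ i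
... | yes refl = contradiction (trans (sym (updateAt-updates i Y)) Y∖i-j) λ ()
... | no  j≢i  = trans (sym (updateAt-minimal j i Y j≢i)) Y∖i-j

⊆∖⇒∉ : (S Y : Sel k) (i : Fin k) → S ⊆ Y ∖ i → S i ≡ false
⊆∖⇒∉ S Y i S⊆Y∖i with S i in Si
... | false = refl
... | true  = contradiction (trans (sym (updateAt-updates i Y)) (S⊆Y∖i Si)) λ ()

odd : ℕ → Bool
odd zero    = false
odd (suc n) = not (odd n)

parity≡odd-size : (S : Sel k) → parity S ≡ odd (size S)
parity≡odd-size {zero}  S = refl
parity≡odd-size {suc k} S with S zero
... | true  = cong not (parity≡odd-size (tail S))
... | false = parity≡odd-size (tail S)

∑ : (Fin k → V n) → V n
∑ p = sumSel p (const true)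

enumerate : (S : Sel k) → ∃ λ (f : Fin (size S) → Fin k) →
  Injective _≡_ _≡_ f × (∀ {n} (p : Fin k → V n) → sumSel p S ≡ ∑ (p ∘ f))
enumerate {zero}  S = (λ ()) , (λ {}) , λ p → refl
enumerate {suc k} S with S zero | enumerate (tail S)
... | true  | f , f-injective , sum-f = (zero ∷ suc ∘ f) , injective , λ p → cong (head p ⊕_) (sum-f (tail p))
  where
  injective : Injective _≡_ _≡_ (zero ∷ suc ∘ f)
  injective {zero}  {zero}  _  = refl
  injective {suc x} {suc y} eq = cong suc (f-injective (Fin.suc-injective eq))
... | false | f , f-injective , sum-f = suc ∘ f , f-injective ∘ Fin.suc-injective , λ p → sum-f (tail p)

-- Gaussian elimination

record Dependency (w : Fin k → Sel m) (Y : Sel k) : Set where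
  field
    coeffs   : Sel k
    support  : coeffs ⊆ Y
    nonempty : Nonempty coeffs
    vanishes : combine coeffs w ≗ ∅

-- Clear column 0 by adding row r to every row with a 1 there, then drop that column.
reduce : Fin k → (Fin k → Sel (suc m)) → Fin k → Sel m
reduce r w i j = w i (suc j) xor (head (w i) ∧ w r (suc j))

combine-reduce : (T : Sel k) (r : Fin k) (w : Fin k → Sel (suc m)) (j : Fin m) →
  combine T (reduce r w) j ≡ combine T w (suc j) xor (combine T w zero ∧ w r (suc j))
combine-reduce T r w j = begin
  parity (λ i → T i ∧ (w i (suc j) xor (head (w i) ∧ x)))
    ≡⟨ parity-cong (λ i → trans (∧-distribˡ-xor (T i) _ _)
                                (cong ((T i ∧ w i (suc j)) xor_) (sym (∧-assoc (T i) _ x)))) ⟩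
  parity ((λ i → T i ∧ w i (suc j)) ⊕ˢ (λ i → (T i ∧ head (w i)) ∧ x))
    ≡⟨ parity-⊕ (λ i → T i ∧ w i (suc j)) (λ i → (T i ∧ head (w i)) ∧ x) ⟩
  combine T w (suc j) xor parity (λ i → (T i ∧ head (w i)) ∧ x)
    ≡⟨ cong (combine T w (suc j) xor_) (parity-∧ʳ (λ i → T i ∧ head (w i)) x) ⟩
  combine T w (suc j) xor (combine T w zero ∧ x)
    ∎
  where x = w r (suc j)

dependency-zero-column : (w : Fin k → Sel (suc m)) (Y : Sel k) →
  (∀ {i} → Y i ≡ true → head (w i) ≡ false) → Dependency (tail ∘ w) Y → Dependency w Y
dependency-zero-column {k} w Y zero-column D = record
  { coeffs = coeffs ; support = support ; nonempty = nonempty ; vanishes = λ where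
      zero    → trans (parity-cong term-vanishes) (parity-∅ {k})
      (suc j) → vanishes j }
  where
  open Dependency D
  term-vanishes : ∀ i → coeffs i ∧ head (w i) ≡ false
  term-vanishes i with coeffs i in Ti
  ... | false = refl
  ... | true  = zero-column (support Ti)

dependency-pivot : (w : Fin k → Sel (suc m)) (Y : Sel k) {r : Fin k} →
  Y r ≡ true → head (w r) ≡ true → Dependency (reduce r w) (Y ∖ r) → Dependency w Y
dependency-pivot w Y {r} Yr pivot D = record
  { coeffs = T ; support = T⊆Y ; nonempty = i , trans (agrees i≢r) T′i ; vanishes = T-vanishes }
  where
  open Dependency D renaming (coeffs to T′; support to T′⊆Y∖r; nonempty to T′-nonempty)
  i = proj₁ T′-nonempty
  T′i = proj₂ T′-nonempty
  β = combine T′ w zero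
  T : Sel _
  T = T′ ⊕ˢ (λ j → β ∧ ⁅ r ⁆ j)

  agrees : ∀ {j} → j ≢ r → T j ≡ T′ j
  agrees {j} j≢r = begin
    T′ j xor (β ∧ ⁅ r ⁆ j)  ≡⟨ cong (λ b → T′ j xor (β ∧ b)) (updateAt-minimal j r ∅ j≢r) ⟩
    T′ j xor (β ∧ false)    ≡⟨ cong (T′ j xor_) (∧-zeroʳ β) ⟩
    T′ j xor false          ≡⟨ xor-identityʳ (T′ j) ⟩
    T′ j                    ∎

  i≢r : i ≢ r
  i≢r refl = contradiction (trans (sym T′i) (⊆∖⇒∉ T′ Y r T′⊆Y∖r)) λ ()

  T⊆Y : T ⊆ Y
  T⊆Y {j} Tj with j ≟ r
  ... | yes refl = Yr
  ... | no  j≢r  = ∖-⊆ Y r (T′⊆Y∖r (trans (sym (agrees j≢r)) Tj))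

  T-vanishes : combine T w ≗ ∅
  T-vanishes zero = begin
    combine T w zero        ≡⟨ combine-add-row T′ β r w zero ⟩
    β xor (β ∧ head (w r))  ≡⟨ cong (λ b → β xor (β ∧ b)) pivot ⟩
    β xor (β ∧ true)        ≡⟨ cong (β xor_) (∧-identityʳ β) ⟩
    β xor β                 ≡⟨ xor-same β ⟩
    false                   ∎
  T-vanishes (suc j) = begin
    combine T w (suc j)                               ≡⟨ combine-add-row T′ β r w (suc j) ⟩
    combine T′ w (suc j) xor (β ∧ w r (suc j))        ≡⟨ sym (combine-reduce T′ r w j) ⟩
    combine T′ (reduce r w) j                         ≡⟨ vanishes j ⟩
    false                                             ∎

dependency : ∀ m (Y : Sel k) (w : Fin k → Sel m) → m < size Y → Dependency w Y
dependency zero Y w 0<size = record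
  { coeffs = Y ; support = id ; nonempty = size>0⇒nonempty Y 0<size ; vanishes = λ () }
dependency (suc m) Y w m<size with any? (λ i → (Y i ≟ᵇ true) ×-dec (head (w i) ≟ᵇ true))
... | yes (r , Yr , pivot) = dependency-pivot w Y Yr pivot
  (dependency m (Y ∖ r) (reduce r w) (s≤s⁻¹ (subst (suc (suc m) ≤_) (size-∖ Y Yr) m<size)))
... | no  ¬pivot = dependency-zero-column w Y (λ Yi → ¬-not (λ wi → ¬pivot (_ , Yi , wi)))
  (dependency m Y (tail ∘ w) (<⇒≤ m<size))

IsCap-∘ : {c : Fin k → V n} {f : Fin m → Fin k} → IsCap c → Injective _≡_ _≡_ f → IsCap (c ∘ f)
IsCap-∘ {f = f} (c-injective , no-quad) f-injective =
  f-injective ∘ c-injective ,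
  λ w x y z w≢x w≢y w≢z x≢y x≢z y≢z → no-quad (f w) (f x) (f y) (f z)
    (w≢x ∘ f-injective) (w≢y ∘ f-injective) (w≢z ∘ f-injective)
    (x≢y ∘ f-injective) (x≢z ∘ f-injective) (y≢z ∘ f-injective)

cap₂-∑≢𝟎 : (c : Fin 2 → V n) → IsCap c → ∑ c ≢ 𝟎
cap₂-∑≢𝟎 c (c-injective , _) ∑c≡𝟎 = contradiction (c-injective (⊕-cancel _ _ c₀⊕c₁≡𝟎)) λ ()
  where
  c₀⊕c₁≡𝟎 : c (# 0) ⊕ c (# 1) ≡ 𝟎
  c₀⊕c₁≡𝟎 = trans (cong (c (# 0) ⊕_) (sym (⊕-identityʳ (c (# 1))))) ∑c≡𝟎

cap₄-∑≢𝟎 : (c : Fin 4 → V n) → IsCap c → ∑ c ≢ 𝟎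
cap₄-∑≢𝟎 c (_ , no-quad) ∑c≡𝟎 =
  no-quad (# 0) (# 1) (# 2) (# 3) (λ ()) (λ ()) (λ ()) (λ ()) (λ ()) (λ ()) (begin
    c₀ ⊕ c₁ ⊕ c₂ ⊕ c₃            ≡⟨ ⊕-assoc (c₀ ⊕ c₁) c₂ c₃ ⟩
    c₀ ⊕ c₁ ⊕ (c₂ ⊕ c₃)          ≡⟨ ⊕-assoc c₀ c₁ (c₂ ⊕ c₃) ⟩
    c₀ ⊕ (c₁ ⊕ (c₂ ⊕ c₃))        ≡⟨ cong (λ x → c₀ ⊕ (c₁ ⊕ (c₂ ⊕ x))) (sym (⊕-identityʳ c₃)) ⟩
    ∑ c                          ≡⟨ ∑c≡𝟎 ⟩
    𝟎                            ∎)
  where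
  c₀ = c (# 0) ; c₁ = c (# 1) ; c₂ = c (# 2) ; c₃ = c (# 3)

cap-∑≡𝟎-even⇒≥6 : ∀ w (c : Fin w → V n) → IsCap c → ∑ c ≡ 𝟎 → odd w ≡ false → 0 < w → 6 ≤ w
cap-∑≡𝟎-even⇒≥6 0 _ _ _ _ ()
cap-∑≡𝟎-even⇒≥6 1 _ _ _ () _
cap-∑≡𝟎-even⇒≥6 2 c cap ∑c≡𝟎 _ _ = contradiction ∑c≡𝟎 (cap₂-∑≢𝟎 c cap)
cap-∑≡𝟎-even⇒≥6 3 _ _ _ () _
cap-∑≡𝟎-even⇒≥6 4 c cap ∑c≡𝟎 _ _ = contradiction ∑c≡𝟎 (cap₄-∑≢𝟎 c cap)
cap-∑≡𝟎-even⇒≥6 5 _ _ _ () _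
cap-∑≡𝟎-even⇒≥6 (suc (suc (suc (suc (suc (suc w)))))) _ _ _ _ _ = s≤s (s≤s (s≤s (s≤s (s≤s (s≤s z≤n)))))

cap-sumSel≡𝟎-even⇒≥6 : {c : Fin k → V n} (S : Sel k) → IsCap c →
  sumSel c S ≡ 𝟎 → parity S ≡ false → Nonempty S → 6 ≤ size S
cap-sumSel≡𝟎-even⇒≥6 {c = c} S cap sum≡𝟎 even nonempty =
  cap-∑≡𝟎-even⇒≥6 (size S) (c ∘ f) (IsCap-∘ cap f-injective) (trans (sym (sum-f c)) sum≡𝟎)
    (trans (sym (parity≡odd-size S)) even) (nonempty⇒size>0 S nonempty)
  where
  f = proj₁ (enumerate S)
  f-injective = proj₁ (proj₂ (enumerate S))
  sum-f = proj₂ (proj₂ (enumerate S))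

-- The counting argument

spanWeight : Sel k → Sel k → Sel k → ℕ
spanWeight A B C =
  size A + size B + size (A ⊕ˢ B) + size C + size (A ⊕ˢ C) + size (B ⊕ˢ C) + size (A ⊕ˢ B ⊕ˢ C)

-- A nonzero linear functional on Z₂³ is 1 at exactly 4 of the 7 nonzero points.
coordinate-weight≤4 : ∀ a b c →
  bit a + bit b + bit (a xor b) + bit c + bit (a xor c) + bit (b xor c) + bit ((a xor b) xor c) ≤ 4
coordinate-weight≤4 false false false = z≤n
coordinate-weight≤4 false false true  = ≤-refl
coordinate-weight≤4 false true  false = ≤-refl
coordinate-weight≤4 false true  true  = ≤-refl
coordinate-weight≤4 true  false false = ≤-refl
coordinate-weight≤4 true  false true  = ≤-refl
coordinate-weight≤4 true  true  false = ≤-refl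
coordinate-weight≤4 true  true  true  = ≤-refl

spanWeight≤4k : (A B C : Sel k) → spanWeight A B C ≤ 4 * k
spanWeight≤4k {zero}  A B C = z≤n
spanWeight≤4k {suc k} A B C =
  subst₂ _≤_
    (sym (regroup (bit a) (bit b) (bit (a xor b)) (bit c) (bit (a xor c)) (bit (b xor c)) (bit ((a xor b) xor c))
                  (size A′) (size B′) (size (A′ ⊕ˢ B′)) (size C′) (size (A′ ⊕ˢ C′)) (size (B′ ⊕ˢ C′))
                  (size (A′ ⊕ˢ B′ ⊕ˢ C′))))
    (sym (*-suc 4 k))
    (+-mono-≤ (coordinate-weight≤4 a b c) (spanWeight≤4k A′ B′ C′))
  where
  a = head A ; b = head B ; c = head C
  A′ = tail A ; B′ = tail B ; C′ = tail C
  regroup : ∀ x₁ x₂ x₃ x₄ x₅ x₆ x₇ y₁ y₂ y₃ y₄ y₅ y₆ y₇ →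
    (x₁ + y₁) + (x₂ + y₂) + (x₃ + y₃) + (x₄ + y₄) + (x₅ + y₅) + (x₆ + y₆) + (x₇ + y₇)
    ≡ (x₁ + x₂ + x₃ + x₄ + x₅ + x₆ + x₇) + (y₁ + y₂ + y₃ + y₄ + y₅ + y₆ + y₇)
  regroup = solve-∀

module CapDependencies {p : Fin m → V n} {c : Fin k → V n} (cap : IsCap c) (c∈aff : ∀ i → InAff p (c i)) where

  private
    coeffs : Fin k → Sel m
    coeffs = proj₁ ∘ c∈aff

  IsDependency : Sel k → Set
  IsDependency T = combine T coeffs ≗ ∅

  infixl 6 _⊕ᵈ_
  _⊕ᵈ_ : ∃ IsDependency → ∃ IsDependency → ∃ IsDependency
  (S , S-dep) ⊕ᵈ (T , T-dep) = S ⊕ˢ T , λ j → trans (combine-⊕ S T coeffs j) (cong₂ _xor_ (S-dep j) (T-dep j))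

  dependency-size≥6 : ((T , _) : ∃ IsDependency) → Nonempty T → 6 ≤ size T
  dependency-size≥6 (T , T-dep) = cap-sumSel≡𝟎-even⇒≥6 T cap sum≡𝟎 even
    where
    sum≡𝟎 : sumSel c T ≡ 𝟎
    sum≡𝟎 = begin
      sumSel c T                            ≡⟨ sumSel-cong (λ i → sym (proj₂ (proj₂ (c∈aff i)))) (λ _ → refl) ⟩
      sumSel (λ i → sumSel p (coeffs i)) T  ≡⟨ sym (sumSel-combine p T coeffs) ⟩
      sumSel p (combine T coeffs)           ≡⟨ sumSel-cong (λ _ → refl) T-dep ⟩
      sumSel p ∅                            ≡⟨ sumSel-∅ p ⟩
      𝟎                                     ∎
    even : parity T ≡ false
    even = begin
      parity T                   ≡⟨ sym (parity-combine-odd T coeffs (proj₁ ∘ proj₂ ∘ c∈aff)) ⟩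
      parity (combine T coeffs)  ≡⟨ parity-cong T-dep ⟩
      parity {m} ∅               ≡⟨ parity-∅ {m} ⟩
      false                      ∎

  echelon-spanWeight≥42 : ((T₁ , _) (T₂ , _) (T₃ , _) : ∃ IsDependency) {a b : Fin k} →
    T₁ a ≡ true → T₂ a ≡ false → T₂ b ≡ true → T₃ a ≡ false → T₃ b ≡ false → Nonempty T₃ →
    42 ≤ spanWeight T₁ T₂ T₃
  echelon-spanWeight≥42 d₁ d₂ d₃ {a} {b} T₁a T₂a T₂b T₃a T₃b T₃-nonempty =
    +-mono-≤ (+-mono-≤ (+-mono-≤ (+-mono-≤ (+-mono-≤ (+-mono-≤
      (dependency-size≥6 d₁ (a , T₁a))
      (dependency-size≥6 d₂ (b , T₂b)))
      (dependency-size≥6 (d₁ ⊕ᵈ d₂) (a , cong₂ _xor_ T₁a T₂a)))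
      (dependency-size≥6 d₃ T₃-nonempty))
      (dependency-size≥6 (d₁ ⊕ᵈ d₃) (a , cong₂ _xor_ T₁a T₃a)))
      (dependency-size≥6 (d₂ ⊕ᵈ d₃) (b , cong₂ _xor_ T₂b T₃b)))
      (dependency-size≥6 (d₁ ⊕ᵈ d₂ ⊕ᵈ d₃) (a , cong₂ _xor_ (cong₂ _xor_ T₁a T₂a) T₃a))

10-cap⊄aff-of-≤7 : {p : Fin m → V n} {c : Fin 10 → V n} → m ≤ 7 → IsCap c → ¬ (∀ i → InAff p (c i))
10-cap⊄aff-of-≤7 {m} m≤7 cap c∈aff =
  contradiction (≤-trans 42≤weight (spanWeight≤4k T₁ T₂ T₃)) (from-no (42 ≤? 40))
  where
  open CapDependencies cap c∈aff
  w = proj₁ ∘ c∈aff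

  Y₁ : Sel 10
  Y₁ _ = true
  open Dependency (dependency m Y₁ w (s≤s (m≤n⇒m≤1+n (m≤n⇒m≤1+n m≤7))))
    using () renaming (coeffs to T₁; vanishes to T₁-dep; nonempty to a∈T₁)
  a = proj₁ a∈T₁

  Y₂ = Y₁ ∖ a
  size-Y₂ : size Y₂ ≡ 9
  size-Y₂ = suc-injective (sym (size-∖ Y₁ {a} refl))
  open Dependency (dependency m Y₂ w (subst (m <_) (sym size-Y₂) (s≤s (m≤n⇒m≤1+n m≤7))))
    using () renaming (coeffs to T₂; vanishes to T₂-dep; nonempty to b∈T₂; support to T₂⊆Y₂)
  b = proj₁ b∈T₂

  Y₃ = Y₂ ∖ b
  size-Y₃ : size Y₃ ≡ 8
  size-Y₃ = suc-injective (trans (sym (size-∖ Y₂ (T₂⊆Y₂ (proj₂ b∈T₂)))) size-Y₂)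
  open Dependency (dependency m Y₃ w (subst (m <_) (sym size-Y₃) (s≤s m≤7)))
    using () renaming (coeffs to T₃; vanishes to T₃-dep; nonempty to T₃-nonempty; support to T₃⊆Y₃)

  T₃a = ⊆∖⇒∉ T₃ Y₁ a (∖-⊆ Y₂ b ∘ T₃⊆Y₃)
  T₃b = ⊆∖⇒∉ T₃ Y₂ b T₃⊆Y₃

  42≤weight : 42 ≤ spanWeight T₁ T₂ T₃
  42≤weight = echelon-spanWeight≥42 (T₁ , T₁-dep) (T₂ , T₂-dep) (T₃ , T₃-dep)
    (proj₂ a∈T₁) (⊆∖⇒∉ T₂ Y₁ a T₂⊆Y₂) (proj₂ b∈T₂) T₃a T₃b T₃-nonempty

cap-in-6-flat-≤9 : (p : Fin 7 → V n) (c : Fin k → V n) → IsCap c → (∀ i → InAff p (c i)) → k ≤ 9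
cap-in-6-flat-≤9 {k = k} p c cap c∈aff with k ≤? 9
... | yes k≤9 = k≤9
... | no  k≰9 = contradiction (c∈aff ∘ f) (10-cap⊄aff-of-≤7 ≤-refl (IsCap-∘ cap f-injective))
  where
  10≤k = ≰⇒> k≰9
  f : Fin 10 → Fin k
  f i = inject≤ i 10≤k
  f-injective : Injective _≡_ _≡_ f
  f-injective = inject≤-injective 10≤k 10≤k _ _

10-cap-dim≥7 : (c : Fin 10 → V n) → IsCap c → HasDim c d → 7 ≤ d
10-cap-dim≥7 {d = d} c cap (q , _ , aff-c⇔aff-q) with 7 ≤? d
... | yes 7≤d = 7≤d
... | no  7≰d = contradiction (λ i → Equivalence.to (aff-c⇔aff-q (c i)) (InAff-point c i))
                              (10-cap⊄aff-of-≤7 (≰⇒> 7≰d) cap)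

-- Explicit caps

-- basis 0 = 𝟎 and basis (suc j) = e_j, the j-th unit vector.
basis : Fin (suc m) → V m
basis i = tabulate (λ j → ⁅ suc j ⁆ i)

lookup-sumSel-basis : (S : Sel (suc m)) (j : Fin m) → lookup (sumSel basis S) j ≡ S (suc j)
lookup-sumSel-basis S j = begin
  lookup (sumSel basis S) j                ≡⟨ lookup-sumSel basis S j ⟩
  parity (λ i → S i ∧ lookup (basis i) j)  ≡⟨ parity-cong (λ i → trans (cong (S i ∧_) (lookup∘tabulate (λ j′ → ⁅ suc j′ ⁆ i) j))
                                                                       (∧-comm (S i) _)) ⟩
  parity (λ i → ⁅ suc j ⁆ i ∧ S i)         ≡⟨ parity-⁅⁆∧ (suc j) S ⟩
  S (suc j)                                ∎

basis-affIndep : AffIndep (basis {m})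
basis-affIndep {m} S even sum≡𝟎 = λ where
    zero    → begin
      head S                          ≡⟨ sym (xor-identityʳ (head S)) ⟩
      head S xor false                ≡⟨ cong (head S xor_) (sym (trans (parity-cong tail≗∅) (parity-∅ {m}))) ⟩
      head S xor parity (tail S)      ≡⟨ even ⟩
      false                           ∎
    (suc j) → tail≗∅ j
  where
  tail≗∅ : tail S ≗ ∅
  tail≗∅ j = trans (sym (lookup-sumSel-basis S j)) (trans (cong (λ x → lookup x j) sum≡𝟎) (lookup-replicate j false))

InAff-basis : (x : V m) → InAff basis x
InAff-basis x = S , xor-inverseˡ (parity (lookup x)) , (begin
  sumSel basis S                      ≡⟨ sym (tabulate∘lookup _) ⟩
  tabulate (lookup (sumSel basis S))  ≡⟨ tabulate-cong (lookup-sumSel-basis S) ⟩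
  tabulate (lookup x)                 ≡⟨ tabulate∘lookup x ⟩
  x                                   ∎)
  where
  S : Sel _
  S = not (parity (lookup x)) ∷ lookup x

isCap? : (c : Fin k → V n) → Dec (IsCap c)
isCap? c = injective? ×-dec no-quad?
  where
  _≟ᵛ_ = ≡-dec _≟ᵇ_
  injective? = map′ (λ inj {i} {j} → inj i j) (λ inj i j → inj)
    (all? λ i → all? λ j → (c i ≟ᵛ c j) →-dec (i ≟ j))
  no-quad? = all? λ w → all? λ x → all? λ y → all? λ z →
    ¬? (w ≟ x) →-dec ¬? (w ≟ y) →-dec ¬? (w ≟ z) →-dec ¬? (x ≟ y) →-dec ¬? (x ≟ z) →-dec ¬? (y ≟ z) →-dec
    ¬? ((c w ⊕ c x ⊕ c y ⊕ c z) ≟ᵛ 𝟎)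

cap₉ : Fin 9 → V 6
cap₉ = basis ++ (e (# 1) ⊕ e (# 2) ⊕ e (# 3) ⊕ e (# 4) ∷ e (# 3) ⊕ e (# 4) ⊕ e (# 5) ⊕ e (# 6) ∷ [])
  where e = basis

cap₁₀ : Fin 10 → V 7
cap₁₀ = basis ++ (e (# 1) ⊕ e (# 2) ⊕ e (# 3) ⊕ e (# 4) ∷ e (# 4) ⊕ e (# 5) ⊕ e (# 6) ⊕ e (# 7) ∷ [])
  where e = basis

cap₁₀-dim : HasDim cap₁₀ 7
cap₁₀-dim = basis , basis-affIndep , λ x → mk⇔ (λ _ → InAff-basis x) (InAff-trans basis∈aff)
  where
  basis∈aff : ∀ i → InAff cap₁₀ (basis i)
  basis∈aff i = subst (InAff cap₁₀) (lookup-++ˡ basis _ i) (InAff-point cap₁₀ (i ↑ˡ 2))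

M₆≡9 : IsM 6 9
M₆≡9 = (6 , basis , cap₉ , from-yes (isCap? cap₉) , basis-affIndep , InAff-basis ∘ cap₉)
     , λ n p k c cap → cap-in-6-flat-≤9 p c cap ∘ proj₂

r₁₀≡7 : IsR 10 7
r₁₀≡7 = (7 , cap₁₀ , from-yes (isCap? cap₁₀) , cap₁₀-dim) , λ n c d → 10-cap-dim≥7 c

corollary6p14 : IsM 6 9 × IsR 10 7
corollary6p14 = M₆≡9 , r₁₀≡7
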